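{- Let $G$ be a graph with $V(G)=\{v_1,\ldots,v_n\}$, let $t$ be a prime power, and let $\mathcal{H}=(L,H)$ be a good prime cover of $G$ of order $t$. View the graph polynomial $f_G(x_1,\ldots,x_n)=\prod_{v_iv_j\in E(G),\, j>i}(x_i-x_j)$ as an element of $\mathbb{F}_t[x_1,\ldots,x_n]$. If $t_1,\ldots,t_n$ are nonnegative integers such that the coefficient of $\prod_{i=1}^n x_i^{t_i}$ in the expansion of $f_G$ is nonzero and $|L(v_i)|>t_i$ for each $i\in[n]$, then there exists an $\mathcal{H}$-coloring of $G$.
   Context: All graphs are finite and simple. A cover of a graph $G$ is a pair $\mathcal{H}=(L,H)$ where $H$ is a graph and $L:V(G)\to\mathcal{P}(V(H))$ satisfies: (1) $\{L(u):u\in V(G)\}$ is a partition of $V(H)$; (2) each $H[L(u)]$ is complete; (3) if $E_H(L(u),L(v))\neq\emptyset$ then $u=v$ or $uv\in E(G)$; (4) if $uv\in E(G)$ then $E_H(L(u),L(v))$ is a matching (possibly empty). An $\mathcal{H}$-coloring of $G$ is an independent set in $H$ of size $|V(G)|$ (equivalently, an independent set meeting each $L(u)$ in exactly one vertex). For $f:V(G)\to\mathbb{N}$, $\mathcal{H}$ is an $f$-cover if $|L(u)|=f(u)$ for all $u$. $\mathbb{F}_t$ denotes the finite field of order $t$. A cover $\mathcal{H}$ is a prime cover of order $t$ if $t$ is a prime power and $|L(v)|\le t$ for all $v$; its vertices are named so that $L(v)\subseteq\{(v,j):j\in\mathbb{F}_t\}$. For an edge $v_iv_j$ with $j>i$,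 let $A_{v_iv_j}$ (resp. $B_{v_iv_j}$) be the set of second coordinates of vertices of $L(v_i)$ (resp. $L(v_j)$) saturated by the matching $E_H(L(v_i),L(v_j))$, and the saturation function $\sigma_{v_iv_j}:A_{v_iv_j}\to B_{v_iv_j}$ sends $q$ to the unique $r$ with $(v_i,q)(v_j,r)\in E(H)$. It is good if there is $\beta\in\mathbb{F}_t$ with $a-\sigma_{v_iv_j}(a)=\beta$ for all $a\in A_{v_iv_j}$ (subtraction in $\mathbb{F}_t$; it is good if $A_{v_iv_j}=\emptyset$), and bad otherwise. A prime cover of order $t$ is good if there exists a naming of the vertices of $H$ with $L(v)\subseteq\{(v,j):j\in\mathbb{F}_t\}$ for which every saturation function (for every edge $v_iv_j$, $j>i$) is good. -}

module Defs where

open import Level using (0ℓ)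
open import Data.Nat as ℕ using (ℕ; zero; suc; _<_; _≤_)
open import Data.Nat.Primality using (Prime)
open import Data.Fin as Fin using (Fin)
open import Data.Fin.Properties using (_≟_)
open import Data.Bool using (Bool; true; false; T)
open import Data.List using (List; []; _∷_; filter; length; concatMap; map; foldr; allFin)
open import Data.Product using (Σ; ∃; ∃-syntax; _×_; _,_; proj₁; proj₂)
open import Relation.Nullary using (¬_; Dec; yes; no)
open import Relation.Binary.PropositionalEquality using (_≡_)
open import Algebra.Structures using (IsCommutativeRing)
open import Function.Bundles using (_↔_)

IsPrimePower : ℕ → Set
IsPrimePower t = Σ ℕ λ p → Σ ℕ λ k → Prime p × 1 ≤ k × t ≡ p ℕ.^ k

record FiniteField (t : ℕ) : Set₁ where
  infixl 6 _+_
  infixl 7 _*_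
  field
    Carrier : Set
    _+_ _*_ : Carrier → Carrier → Carrier
    -_      : Carrier → Carrier
    0# 1#   : Carrier
    isCommutativeRing : IsCommutativeRing _≡_ _+_ _*_ -_ 0# 1#
    0≢1     : ¬ (0# ≡ 1#)
    inverse : ∀ x → ¬ (x ≡ 0#) → Σ Carrier λ y → x * y ≡ 1#
    enum    : Carrier ↔ Fin t

  _-_ : Carrier → Carrier → Carrier
  x - y = x + (- y)

record Graph (n : ℕ) : Set where
  field
    Adj   : Fin n → Fin n → Bool
    sym   : ∀ u v → Adj u v ≡ Adj v u
    irrefl : ∀ v → Adj v v ≡ false

open Graph public

-- Covers.  H has vertex set Fin m; L is encoded by the map part : Fin m → Fin n
-- sending each vertex of H to the unique u with that vertex in L(u)
-- (so {L(u)} partitions V(H)).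

record Cover {n : ℕ} (G : Graph n) : Set where
  field
    m      : ℕ
    part   : Fin m → Fin n
    AdjH   : Fin m → Fin m → Bool
    symH   : ∀ x y → AdjH x y ≡ AdjH y x
    irreflH : ∀ x → AdjH x x ≡ false
    complete : ∀ x y → part x ≡ part y → ¬ (x ≡ y) → AdjH x y ≡ true
    respects : ∀ x y → AdjH x y ≡ true → ¬ (part x ≡ part y) →
               Adj G (part x) (part y) ≡ true
    matching : ∀ x y z → AdjH x y ≡ true → AdjH x z ≡ true →
               ¬ (part x ≡ part y) → part y ≡ part z → y ≡ z

open Cover public

L : ∀ {n} {G : Graph n} (C : Cover G) → Fin n → List (Fin (m C))
L C u = filter (λ x → part C x ≟ u) (allFin (m C))

∣L∣ : ∀ {n} {G : Graph n} (C : Cover G) → Fin n → ℕ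
∣L∣ C u = length (L C u)

-- An H-coloring: an independent set in H meeting each L(u) in exactly one
-- vertex (given as a choice of one vertex of each L(u), pairwise non-adjacent).
Coloring : ∀ {n} {G : Graph n} → Cover G → Set
Coloring {n} C =
  Σ (Fin n → Fin (m C)) λ c →
    (∀ u → part C (c u) ≡ u) × (∀ u v → AdjH C (c u) (c v) ≡ false)

-- A naming assigns to each vertex x ∈ L(v) a name (v, ν x) with ν x ∈ F_t,
-- distinct vertices in the same list getting distinct names
-- (so L(v) ⊆ {(v,j) : j ∈ F_t}, whence |L(v)| ≤ t).
-- Good: for every edge v_i v_j (i < j) there is β with
--   a - σ(a) = β for all saturated a, i.e. ν x - ν y = β for every
--   H-edge xy with x ∈ L(v_i), y ∈ L(v_j).

IsGoodPrimeCover : ∀ {n} {G : Graph n} (t : ℕ) → FiniteField t → Cover G → Set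
IsGoodPrimeCover {n} {G} t F C =
  IsPrimePower t ×
  (∀ u → ∣L∣ C u ≤ t) ×
  Σ (Fin (m C) → FiniteField.Carrier F) λ ν →
    (∀ x y → part C x ≡ part C y → ν x ≡ ν y → x ≡ y) ×
    (∀ (i j : Fin n) → i Fin.< j → Adj G i j ≡ true →
       Σ (FiniteField.Carrier F) λ β →
         ∀ x y → part C x ≡ i → part C y ≡ j → AdjH C x y ≡ true →
           FiniteField._-_ F (ν x) (ν y) ≡ β)

-- Multivariate polynomials over F in x_1,…,x_n, represented as (unreduced)
-- lists of terms c·x^e with exponent vector e : Fin n → ℕ.

module Poly {t : ℕ} (F : FiniteField t) (n : ℕ) where
  open FiniteField F

  Monomial : Set
  Monomial = Fin n → ℕ

  Term : Set
  Term = Carrier × Monomial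

  Polynomial : Set
  Polynomial = List Term

  one : Polynomial
  one = (1# , (λ _ → 0)) ∷ []

  var : Fin n → Monomial
  var i j with i ≟ j
  ... | yes _ = 1
  ... | no  _ = 0

  diff : Fin n → Fin n → Polynomial
  diff i j = (1# , var i) ∷ (- 1# , var j) ∷ []

  _·_ : Polynomial → Polynomial → Polynomial
  p · q = concatMap (λ a → map (λ b → (proj₁ a * proj₁ b , (λ k → proj₂ a k ℕ.+ proj₂ b k))) q) p

  monEq? : (e f : Monomial) → Dec (∀ k → e k ≡ f k)
  monEq? e f = Data.Fin.Properties.all? (λ k → e k ℕ.≟ f k)
    where import Data.Fin.Properties

  coeff : Polynomial → Monomial → Carrier
  coeff p e = foldr (λ a acc → proj₁ a + acc) 0# (filter (λ a → monEq? (proj₂ a) e) p)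

  pairs : List (Fin n × Fin n)
  pairs = concatMap (λ i → map (λ j → (i , j)) (filter (λ j → i Fin.<? j) (allFin n))) (allFin n)

  graphPoly : Graph n → Polynomial
  graphPoly G = foldr (λ ij acc → diff (proj₁ ij) (proj₂ ij) · acc) one
                  (filter (λ ij → Data.Bool._≟_ (Adj G (proj₁ ij) (proj₂ ij)) true) pairs)
    where import Data.Bool

-- Name the vertices so that every saturation function is a translation a ↦ a - β_ij.
-- Picking names v_i among the first t_i + 1 names of L(v_i), an H-coloring is then
-- exactly a point v of the grid A_1 × ⋯ × A_n with v_i - v_j ≠ β_ij along every edge,
-- i.e. a point where Q = ∏ (x_i - x_j - β_ij) does not vanish.  Iterating the divided
-- difference over the grid gives a linear functional that kills every monomial of
-- degree ≤ Σ t_i except x^t, which it sends to 1.  As f_G is homogeneous of degree |E|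
-- and its coefficient of x^t is non-zero, Σ t_i = |E| and Q differs from f_G by terms
-- of lower degree; so the functional sends Q to that non-zero coefficient, and Q
-- cannot vanish on the whole grid.

module Submission where

open import Defs
open import Data.Nat using (ℕ; _<_)
open import Data.Fin using (Fin)
open import Relation.Nullary using (¬_)
open import Relation.Binary.PropositionalEquality using (_≡_)

open import Level using (0ℓ)
open import Algebra.Bundles using (CommutativeMonoid; CommutativeRing)
import Algebra.Properties.CommutativeMonoid.Sum as CommutativeMonoidSum
import Algebra.Properties.CommutativeSemigroup as CommutativeSemigroupProperties
import Algebra.Properties.Ring as RingProperties
import Algebra.Properties.Semiring.Exp as SemiringExp
open import Data.Nat as ℕ using (zero; suc; _≤_; z≤n; s≤s)
import Data.Nat.Properties as ℕ
open import Data.Fin as Fin using (punchIn)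
import Data.Fin.Properties as Fin
open import Data.Vec.Functional as Vector using (Vector; removeAt)
open import Data.Bool using (true)
import Data.Bool.Properties as Bool
open import Data.Product using (Σ; ∃; _×_; _,_; proj₁; proj₂; uncurry)
open import Data.List using (List; []; _∷_; _++_; length; map; foldr; take; filter; allFin)
import Data.List.Properties as List
open import Data.List.Relation.Unary.All as All using (All; []; _∷_)
import Data.List.Relation.Unary.All.Properties as All
open import Data.List.Relation.Unary.AllPairs using (AllPairs; []; _∷_)
import Data.List.Relation.Unary.AllPairs.Properties as AllPairs
import Data.List.Relation.Unary.Any as Any
open import Data.List.Relation.Unary.Unique.Propositional using (Unique)
import Data.List.Relation.Unary.Unique.Propositional.Properties as Unique
open import Data.List.Membership.Propositional using (_∈_; find)
import Data.List.Membership.Propositional.Properties as Membership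
open import Function using (_∘_)
open import Function.Properties.Inverse using (↔⇒↣)
open import Relation.Binary.Definitions using (DecidableEquality; tri<; tri≈; tri>)
open import Relation.Binary.PropositionalEquality as ≡
  using (_≢_; refl; trans; cong; cong₂; subst₂; _≗_; module ≡-Reasoning)
open import Relation.Nullary using (Dec; yes; no; contradiction)
open import Relation.Nullary.Decidable using (via-injection; _×-dec_)

open ≡-Reasoning

module _ {c ℓ} (M : CommutativeMonoid c ℓ) where
  open CommutativeMonoid M using (Carrier; _≈_; ε; ∙-congˡ; identityʳ) renaming (trans to ≈-trans)
  open CommutativeMonoidSum M using (sum; sum-remove; sum-cong-≋; sum-replicate-zero)

  sum-concentrated : ∀ {n} (f : Vector Carrier n) i → (∀ j → j ≢ i → f j ≈ ε) → sum f ≈ f i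
  sum-concentrated {suc n} f i vanish =
    ≈-trans (sum-remove {i = i} f) (≈-trans (∙-congˡ rest≈ε) (identityʳ (f i)))
    where
    rest≈ε : sum (removeAt f i) ≈ ε
    rest≈ε = ≈-trans (sum-cong-≋ (λ j → vanish (punchIn i j) (Fin.punchInᵢ≢i i j))) (sum-replicate-zero n)

open CommutativeMonoidSum ℕ.+-0-commutativeMonoid
  using () renaming ( sum to ∑; sum-cong-≗ to ∑-cong-≗; sum-replicate-zero to ∑-replicate-0
                    ; ∑-distrib-+ to ∑-distrib-+ᴺ)

∑-mono-≤ : ∀ {n} {f g : Vector ℕ n} → (∀ k → f k ≤ g k) → ∑ f ≤ ∑ g
∑-mono-≤ {zero} _ = z≤n
∑-mono-≤ {suc n} f≤g = ℕ.+-mono-≤ (f≤g Fin.zero) (∑-mono-≤ (f≤g ∘ Fin.suc))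

≤-pointwise-∑≥⇒≗ : ∀ {n} {f g : Vector ℕ n} → (∀ k → f k ≤ g k) → ∑ g ≤ ∑ f → f ≗ g
≤-pointwise-∑≥⇒≗ {suc n} {f} {g} f≤g ∑g≤∑f Fin.zero =
  ℕ.≤-antisym (f≤g Fin.zero) (ℕ.+-cancelʳ-≤ (∑ (g ∘ Fin.suc)) (g Fin.zero) (f Fin.zero)
    (ℕ.≤-trans ∑g≤∑f (ℕ.+-monoʳ-≤ (f Fin.zero) (∑-mono-≤ (f≤g ∘ Fin.suc)))))
≤-pointwise-∑≥⇒≗ {suc n} {f} {g} f≤g ∑g≤∑f (Fin.suc k) =
  ≤-pointwise-∑≥⇒≗ (f≤g ∘ Fin.suc) (ℕ.+-cancelˡ-≤ (g Fin.zero) (∑ (g ∘ Fin.suc)) (∑ (f ∘ Fin.suc))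
    (ℕ.≤-trans ∑g≤∑f (ℕ.+-monoˡ-≤ (∑ (f ∘ Fin.suc)) (f≤g Fin.zero)))) k

∑≤∑∧≢⇒∃< : ∀ {n} (f g : Vector ℕ n) → ∑ f ≤ ∑ g → ¬ (∀ k → f k ≡ g k) → ∃ λ k → f k < g k
∑≤∑∧≢⇒∃< f g ∑f≤∑g f≢g with Fin.any? (λ k → f k ℕ.<? g k)
... | yes f<g = f<g
... | no ¬f<g = contradiction (≡.sym ∘ ≤-pointwise-∑≥⇒≗ (λ k → ℕ.≮⇒≥ (¬f<g ∘ (k ,_))) ∑f≤∑g) f≢g

module FieldProperties {t : ℕ} (F : FiniteField t) where
  open FiniteField F public

  commutativeRing : CommutativeRing 0ℓ 0ℓ
  commutativeRing = record { isCommutativeRing = isCommutativeRing }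

  open CommutativeRing commutativeRing public
    using ( +-assoc; +-comm; +-identityˡ; +-identityʳ; -‿inverseˡ; -‿inverseʳ
          ; *-assoc; *-comm; *-identityˡ; *-identityʳ; zeroˡ; zeroʳ; distribˡ; distribʳ
          ; *-commutativeMonoid)
  open CommutativeRing commutativeRing
    using (ring; semiring; +-commutativeSemigroup; *-commutativeSemigroup)
  open RingProperties ring public using (-1*x≈-x; -‿distribˡ-*; x∙y⁻¹≈ε⇒x≈y; x≈y⇒x∙y⁻¹≈ε; +-cancelˡ)
  open SemiringExp semiring public using (_^_; ^-homo-*)
  open CommutativeMonoidSum *-commutativeMonoid public
    using () renaming ( sum to ∏; sum-cong-≗ to ∏-cong-≗; sum-replicate-zero to ∏-replicate-1
                      ; ∑-distrib-+ to ∏-distrib-*)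
  module + = CommutativeSemigroupProperties +-commutativeSemigroup
  module * = CommutativeSemigroupProperties *-commutativeSemigroup

  _≟_ : DecidableEquality Carrier
  _≟_ = via-injection (↔⇒↣ enum) Fin._≟_

  _⁻¹ : Carrier → Carrier
  x ⁻¹ with x ≟ 0#
  ... | yes _ = 0#
  ... | no x≢0 = proj₁ (inverse x x≢0)

  x*x⁻¹≡1 : ∀ {x} → x ≢ 0# → x * x ⁻¹ ≡ 1#
  x*x⁻¹≡1 {x} x≢0 with x ≟ 0#
  ... | yes x≡0 = contradiction x≡0 x≢0
  ... | no x≢0 = proj₂ (inverse x x≢0)

  x≢0∧x*y≡0⇒y≡0 : ∀ {x y} → x ≢ 0# → x * y ≡ 0# → y ≡ 0#
  x≢0∧x*y≡0⇒y≡0 {x} {y} x≢0 xy≡0 = begin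
    y                ≡⟨ *-identityˡ y ⟨
    1# * y           ≡⟨ cong (_* y) (x*x⁻¹≡1 x≢0) ⟨
    (x * x ⁻¹) * y   ≡⟨ *.xy∙z≈y∙xz x (x ⁻¹) y ⟩
    x ⁻¹ * (x * y)   ≡⟨ cong (x ⁻¹ *_) xy≡0 ⟩
    x ⁻¹ * 0#        ≡⟨ zeroʳ _ ⟩
    0#               ∎

  x*y≢0⇒y≢0 : ∀ x {y} → x * y ≢ 0# → y ≢ 0#
  x*y≢0⇒y≢0 x xy≢0 y≡0 = xy≢0 (trans (cong (x *_) y≡0) (zeroʳ x))

  x≢y⇒x-y≢0 : ∀ {x y} → x ≢ y → x - y ≢ 0#
  x≢y⇒x-y≢0 {x} {y} x≢y = x≢y ∘ x∙y⁻¹≈ε⇒x≈y x y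

  ∏-zero : ∀ {n} (f : Vector Carrier n) i → f i ≡ 0# → ∏ f ≡ 0#
  ∏-zero f Fin.zero f₀≡0 = trans (cong (_* ∏ (Vector.tail f)) f₀≡0) (zeroˡ _)
  ∏-zero f (Fin.suc i) fᵢ≡0 = trans (cong (f Fin.zero *_) (∏-zero (Vector.tail f) i fᵢ≡0)) (zeroʳ _)

  ∏-one : ∀ {n} (f : Vector Carrier n) → (∀ i → f i ≡ 1#) → ∏ f ≡ 1#
  ∏-one {n} f f≡1 = trans (∏-cong-≗ f≡1) (∏-replicate-1 n)

  x-y+y≡x : ∀ x y → (x - y) + y ≡ x
  x-y+y≡x x y = begin
    (x + - y) + y  ≡⟨ +-assoc x (- y) y ⟩
    x + (- y + y)  ≡⟨ cong (x +_) (-‿inverseˡ y) ⟩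
    x + 0#         ≡⟨ +-identityʳ x ⟩
    x              ∎

  x-z≡x-y+y-z : ∀ x y z → x - z ≡ (x - y) + (y - z)
  x-z≡x-y+y-z x y z = begin
    x + - z              ≡⟨ cong (_+ - z) (x-y+y≡x x y) ⟨
    ((x - y) + y) + - z  ≡⟨ +-assoc (x - y) y (- z) ⟩
    (x - y) + (y - z)    ∎

module DividedDifference {t : ℕ} (F : FiniteField t) where
  open FieldProperties F

  inverseProduct : List Carrier → Carrier → Carrier
  inverseProduct [] c = 1#
  inverseProduct (b ∷ R) c = (c - b) ⁻¹ * inverseProduct R c

  -- The divided difference f[c₀,…,cₖ] = Σᵢ f(cᵢ) / ∏_{j ≠ i} (cᵢ - cⱼ), peeled off at c₀.
  divDiff : List Carrier → (Carrier → Carrier) → Carrier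
  divDiff [] f = 0#
  divDiff (c ∷ R) f = f c * inverseProduct R c + divDiff R (λ a → f a * (a - c) ⁻¹)

  divDiff-cong : ∀ A {f g} → All (λ a → f a ≡ g a) A → divDiff A f ≡ divDiff A g
  divDiff-cong [] [] = refl
  divDiff-cong (c ∷ R) (fc≡gc ∷ f≡g) =
    cong₂ _+_ (cong (_* inverseProduct R c) fc≡gc) (divDiff-cong R (All.map (cong (_* _)) f≡g))

  divDiff-cong-≗ : ∀ A {f g} → f ≗ g → divDiff A f ≡ divDiff A g
  divDiff-cong-≗ A f≗g = divDiff-cong A (All.universal f≗g A)

  divDiff-+ : ∀ A f g → divDiff A (λ a → f a + g a) ≡ divDiff A f + divDiff A g
  divDiff-+ [] f g = ≡.sym (+-identityˡ 0#)
  divDiff-+ (c ∷ R) f g = begin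
    (f c + g c) * w + divDiff R (λ a → (f a + g a) * (a - c) ⁻¹)
      ≡⟨ cong₂ _+_ (distribʳ w (f c) (g c)) (divDiff-cong-≗ R (λ a → distribʳ _ (f a) (g a))) ⟩
    (f c * w + g c * w) + divDiff R (λ a → f a * (a - c) ⁻¹ + g a * (a - c) ⁻¹)
      ≡⟨ cong ((f c * w + g c * w) +_) (divDiff-+ R _ _) ⟩
    (f c * w + g c * w) + (divDiff R (λ a → f a * (a - c) ⁻¹) + divDiff R (λ a → g a * (a - c) ⁻¹))
      ≡⟨ +.interchange _ _ _ _ ⟩
    divDiff (c ∷ R) f + divDiff (c ∷ R) g ∎
    where
    w : Carrier
    w = inverseProduct R c

  divDiff-*ˡ : ∀ A k f → divDiff A (λ a → k * f a) ≡ k * divDiff A f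
  divDiff-*ˡ [] k f = ≡.sym (zeroʳ k)
  divDiff-*ˡ (c ∷ R) k f = begin
    (k * f c) * w + divDiff R (λ a → (k * f a) * (a - c) ⁻¹)
      ≡⟨ cong₂ _+_ (*-assoc k (f c) w) (divDiff-cong-≗ R (λ a → *-assoc k (f a) _)) ⟩
    k * (f c * w) + divDiff R (λ a → k * (f a * (a - c) ⁻¹))
      ≡⟨ cong (k * (f c * w) +_) (divDiff-*ˡ R k _) ⟩
    k * (f c * w) + k * divDiff R (λ a → f a * (a - c) ⁻¹)
      ≡⟨ distribˡ k _ _ ⟨
    k * divDiff (c ∷ R) f ∎
    where
    w : Carrier
    w = inverseProduct R c

  divDiff-zero : ∀ A → divDiff A (λ _ → 0#) ≡ 0#
  divDiff-zero A = begin
    divDiff A (λ _ → 0#)       ≡⟨ divDiff-cong-≗ A (λ _ → zeroˡ 0#) ⟨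
    divDiff A (λ _ → 0# * 0#)  ≡⟨ divDiff-*ˡ A 0# (λ _ → 0#) ⟩
    0# * divDiff A (λ _ → 0#)  ≡⟨ zeroˡ _ ⟩
    0#                         ∎

  divDiff≢0⇒∃ : ∀ A f → divDiff A f ≢ 0# → ∃ λ a → a ∈ A × f a ≢ 0#
  divDiff≢0⇒∃ A f divDiff≢0 with All.all? (λ a → f a ≟ 0#) A
  ... | yes f≡0 = contradiction (trans (divDiff-cong A f≡0) (divDiff-zero A)) divDiff≢0
  ... | no f≢0 = find (All.¬All⇒Any¬ (λ a → f a ≟ 0#) A f≢0)

  divDiff-singleton : ∀ c f → divDiff (c ∷ []) f ≡ f c
  divDiff-singleton c f = trans (+-identityʳ _) (*-identityʳ (f c))

  divDiff-linearFactor : ∀ c R g → All (c ≢_) R → divDiff (c ∷ R) (λ a → (a - c) * g a) ≡ divDiff R g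
  divDiff-linearFactor c R g c∉R = begin
    ((c - c) * g c) * inverseProduct R c + divDiff R (λ a → ((a - c) * g a) * (a - c) ⁻¹)
      ≡⟨ cong₂ _+_ vanishes-at-c (divDiff-cong R (All.map cancel c∉R)) ⟩
    0# + divDiff R g ≡⟨ +-identityˡ _ ⟩
    divDiff R g      ∎
    where
    vanishes-at-c : ((c - c) * g c) * inverseProduct R c ≡ 0#
    vanishes-at-c = begin
      ((c - c) * g c) * inverseProduct R c ≡⟨ cong (λ x → (x * g c) * inverseProduct R c) (-‿inverseʳ c) ⟩
      (0# * g c) * inverseProduct R c      ≡⟨ cong (_* inverseProduct R c) (zeroˡ (g c)) ⟩
      0# * inverseProduct R c              ≡⟨ zeroˡ _ ⟩
      0#                                   ∎
    cancel : ∀ {a} → c ≢ a → ((a - c) * g a) * (a - c) ⁻¹ ≡ g a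
    cancel {a} c≢a = begin
      ((a - c) * g a) * (a - c) ⁻¹  ≡⟨ *.xy∙z≈y∙xz _ _ _ ⟩
      g a * ((a - c) * (a - c) ⁻¹)  ≡⟨ cong (g a *_) (x*x⁻¹≡1 (x≢y⇒x-y≢0 (c≢a ∘ ≡.sym))) ⟩
      g a * 1#                      ≡⟨ *-identityʳ _ ⟩
      g a                           ∎

  divDiff-swap : ∀ c d R f → divDiff (c ∷ d ∷ R) f ≡ divDiff (d ∷ c ∷ R) f
  divDiff-swap c d R f = begin
    f c * ((c - d) ⁻¹ * inverseProduct R c)
      + ((f d * (d - c) ⁻¹) * inverseProduct R d + divDiff R (λ a → (f a * (a - c) ⁻¹) * (a - d) ⁻¹))
      ≡⟨ +.x∙yz≈y∙xz _ _ _ ⟩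
    (f d * (d - c) ⁻¹) * inverseProduct R d
      + (f c * ((c - d) ⁻¹ * inverseProduct R c) + divDiff R (λ a → (f a * (a - c) ⁻¹) * (a - d) ⁻¹))
      ≡⟨ cong₂ _+_ (*-assoc _ _ _)
           (cong₂ _+_ (≡.sym (*-assoc _ _ _)) (divDiff-cong-≗ R (λ a → *.xy∙z≈xz∙y (f a) _ _))) ⟩
    divDiff (d ∷ c ∷ R) f ∎

  divDiff-recurrence : ∀ c d R f → c ≢ d → All (c ≢_) R → All (d ≢_) R →
    divDiff (d ∷ R) f ≡ divDiff (c ∷ R) f + (d - c) * divDiff (c ∷ d ∷ R) f
  divDiff-recurrence c d R f c≢d c∉R d∉R = begin
    divDiff (d ∷ R) f
      ≡⟨ divDiff-linearFactor c (d ∷ R) f (c≢d ∷ c∉R) ⟨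
    divDiff (c ∷ d ∷ R) (λ a → (a - c) * f a)
      ≡⟨ divDiff-cong-≗ (c ∷ d ∷ R) telescope ⟩
    divDiff (c ∷ d ∷ R) (λ a → (a - d) * f a + (d - c) * f a)
      ≡⟨ divDiff-+ (c ∷ d ∷ R) _ _ ⟩
    divDiff (c ∷ d ∷ R) (λ a → (a - d) * f a) + divDiff (c ∷ d ∷ R) (λ a → (d - c) * f a)
      ≡⟨ cong₂ _+_ (trans (divDiff-swap c d R _) (divDiff-linearFactor d (c ∷ R) f ((c≢d ∘ ≡.sym) ∷ d∉R)))
                   (divDiff-*ˡ (c ∷ d ∷ R) (d - c) f) ⟩
    divDiff (c ∷ R) f + (d - c) * divDiff (c ∷ d ∷ R) f ∎
    where
    telescope : ∀ a → (a - c) * f a ≡ (a - d) * f a + (d - c) * f a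
    telescope a = trans (cong (_* f a) (x-z≡x-y+y-z a d c)) (distribʳ (f a) _ _)

  divDiff≡0-if-neighbours-agree : ∀ c d R f → c ≢ d → All (c ≢_) R → All (d ≢_) R →
    divDiff (d ∷ R) f ≡ divDiff (c ∷ R) f → divDiff (c ∷ d ∷ R) f ≡ 0#
  divDiff≡0-if-neighbours-agree c d R f c≢d c∉R d∉R agree =
    x≢0∧x*y≡0⇒y≡0 (x≢y⇒x-y≢0 (c≢d ∘ ≡.sym)) (≡.sym (+-cancelˡ (divDiff (c ∷ R) f) _ _ (begin
      divDiff (c ∷ R) f + 0#                                 ≡⟨ +-identityʳ _ ⟩
      divDiff (c ∷ R) f                                      ≡⟨ agree ⟨
      divDiff (d ∷ R) f                                      ≡⟨ divDiff-recurrence c d R f c≢d c∉R d∉R ⟩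
      divDiff (c ∷ R) f + (d - c) * divDiff (c ∷ d ∷ R) f    ∎)))

  divDiff-const : ∀ k c d R → Unique (c ∷ d ∷ R) → divDiff (c ∷ d ∷ R) (λ _ → k) ≡ 0#
  divDiff-const k c d [] ((c≢d ∷ []) ∷ [] ∷ []) =
    divDiff≡0-if-neighbours-agree c d [] _ c≢d [] []
      (trans (divDiff-singleton d _) (≡.sym (divDiff-singleton c _)))
  divDiff-const k c d (r ∷ R) ((c≢d ∷ c≢r ∷ c∉R) ∷ (d≢r ∷ d∉R) ∷ rR-unique) =
    divDiff≡0-if-neighbours-agree c d (r ∷ R) _ c≢d (c≢r ∷ c∉R) (d≢r ∷ d∉R)
      (trans (divDiff-const k d r R ((d≢r ∷ d∉R) ∷ rR-unique))
             (≡.sym (divDiff-const k c r R ((c≢r ∷ c∉R) ∷ rR-unique))))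

  divDiff-x* : ∀ c R g → All (c ≢_) R →
    divDiff (c ∷ R) (λ a → a * g a) ≡ divDiff R g + c * divDiff (c ∷ R) g
  divDiff-x* c R g c∉R = begin
    divDiff (c ∷ R) (λ a → a * g a)
      ≡⟨ divDiff-cong-≗ (c ∷ R) split ⟩
    divDiff (c ∷ R) (λ a → (a - c) * g a + c * g a)
      ≡⟨ divDiff-+ (c ∷ R) _ _ ⟩
    divDiff (c ∷ R) (λ a → (a - c) * g a) + divDiff (c ∷ R) (λ a → c * g a)
      ≡⟨ cong₂ _+_ (divDiff-linearFactor c R g c∉R) (divDiff-*ˡ (c ∷ R) c g) ⟩
    divDiff R g + c * divDiff (c ∷ R) g ∎
    where
    split : ∀ a → a * g a ≡ (a - c) * g a + c * g a
    split a = trans (cong (_* g a) (≡.sym (x-y+y≡x a c))) (distribʳ (g a) (a - c) c)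

  divDiff-^-< : ∀ {k} e A → Unique A → length A ≡ suc k → e < k → divDiff A (_^ e) ≡ 0#
  divDiff-^-< zero (c ∷ d ∷ R) cdR-unique refl _ = divDiff-const 1# c d R cdR-unique
  divDiff-^-< (suc e) (c ∷ d ∷ R) cdR-unique@((c≢d ∷ c∉R) ∷ dR-unique) refl (s≤s e<∣R∣) = begin
    divDiff (c ∷ d ∷ R) (λ a → a * a ^ e)
      ≡⟨ divDiff-x* c (d ∷ R) (_^ e) (c≢d ∷ c∉R) ⟩
    divDiff (d ∷ R) (_^ e) + c * divDiff (c ∷ d ∷ R) (_^ e)
      ≡⟨ cong₂ (λ x y → x + c * y) (divDiff-^-< e (d ∷ R) dR-unique refl e<∣R∣)
                                   (divDiff-^-< e (c ∷ d ∷ R) cdR-unique refl (ℕ.m<n⇒m<1+n e<∣R∣)) ⟩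
    0# + c * 0#
      ≡⟨ trans (+-identityˡ _) (zeroʳ c) ⟩
    0# ∎

  divDiff-^-top : ∀ {k} A → Unique A → length A ≡ suc k → divDiff A (_^ k) ≡ 1#
  divDiff-^-top (c ∷ []) _ refl = divDiff-singleton c (_^ 0)
  divDiff-^-top (c ∷ d ∷ R) cdR-unique@((c≢d ∷ c∉R) ∷ dR-unique) refl = begin
    divDiff (c ∷ d ∷ R) (λ a → a * a ^ length R)
      ≡⟨ divDiff-x* c (d ∷ R) (_^ length R) (c≢d ∷ c∉R) ⟩
    divDiff (d ∷ R) (_^ length R) + c * divDiff (c ∷ d ∷ R) (_^ length R)
      ≡⟨ cong₂ (λ x y → x + c * y) (divDiff-^-top (d ∷ R) dR-unique refl)
                                   (divDiff-^-< (length R) (c ∷ d ∷ R) cdR-unique refl ℕ.≤-refl) ⟩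
    1# + c * 0#
      ≡⟨ trans (cong (1# +_) (zeroʳ c)) (+-identityʳ 1#) ⟩
    1# ∎

module GridDivDiff {t : ℕ} (F : FiniteField t) where
  open FieldProperties F
  open DividedDifference F

  gridDivDiff : ∀ {n} → Vector (List Carrier) n → (Vector Carrier n → Carrier) → Carrier
  gridDivDiff {zero} A g = g Vector.[]
  gridDivDiff {suc n} A g =
    divDiff (Vector.head A) (λ a → gridDivDiff (Vector.tail A) (λ v → g (a Vector.∷ v)))

  gridDivDiff-cong-≗ : ∀ {n} (A : Vector (List Carrier) n) {g h} → g ≗ h → gridDivDiff A g ≡ gridDivDiff A h
  gridDivDiff-cong-≗ {zero} A g≗h = g≗h Vector.[]
  gridDivDiff-cong-≗ {suc n} A g≗h =
    divDiff-cong-≗ (Vector.head A) (λ a → gridDivDiff-cong-≗ (Vector.tail A) (g≗h ∘ (a Vector.∷_)))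

  gridDivDiff-+ : ∀ {n} (A : Vector (List Carrier) n) g h →
    gridDivDiff A (λ v → g v + h v) ≡ gridDivDiff A g + gridDivDiff A h
  gridDivDiff-+ {zero} A g h = refl
  gridDivDiff-+ {suc n} A g h =
    trans (divDiff-cong-≗ (Vector.head A) (λ a → gridDivDiff-+ (Vector.tail A) _ _))
          (divDiff-+ (Vector.head A) _ _)

  gridDivDiff-*ˡ : ∀ {n} (A : Vector (List Carrier) n) k g → gridDivDiff A (λ v → k * g v) ≡ k * gridDivDiff A g
  gridDivDiff-*ˡ {zero} A k g = refl
  gridDivDiff-*ˡ {suc n} A k g =
    trans (divDiff-cong-≗ (Vector.head A) (λ a → gridDivDiff-*ˡ (Vector.tail A) k _))
          (divDiff-*ˡ (Vector.head A) k _)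

  gridDivDiff-zero : ∀ {n} (A : Vector (List Carrier) n) → gridDivDiff A (λ _ → 0#) ≡ 0#
  gridDivDiff-zero {zero} A = refl
  gridDivDiff-zero {suc n} A =
    trans (divDiff-cong-≗ (Vector.head A) (λ a → gridDivDiff-zero (Vector.tail A)))
          (divDiff-zero (Vector.head A))

  gridDivDiff-∏ : ∀ {n} (A : Vector (List Carrier) n) (h : Fin n → Carrier → Carrier) →
    gridDivDiff A (λ v → ∏ (λ k → h k (v k))) ≡ ∏ (λ k → divDiff (A k) (h k))
  gridDivDiff-∏ {zero} A h = refl
  gridDivDiff-∏ {suc n} A h = begin
    divDiff (A Fin.zero) (λ a → gridDivDiff A′ (λ v → h Fin.zero a * ∏ (λ k → h′ k (v k))))
      ≡⟨ divDiff-cong-≗ (A Fin.zero) (λ a → trans (gridDivDiff-*ˡ A′ _ _) (*-comm _ _)) ⟩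
    divDiff (A Fin.zero) (λ a → gridDivDiff A′ (λ v → ∏ (λ k → h′ k (v k))) * h Fin.zero a)
      ≡⟨ cong (λ x → divDiff (A Fin.zero) (λ a → x * h Fin.zero a)) (gridDivDiff-∏ A′ h′) ⟩
    divDiff (A Fin.zero) (λ a → ∏ (λ k → divDiff (A′ k) (h′ k)) * h Fin.zero a)
      ≡⟨ divDiff-*ˡ (A Fin.zero) _ _ ⟩
    ∏ (λ k → divDiff (A′ k) (h′ k)) * divDiff (A Fin.zero) (h Fin.zero)
      ≡⟨ *-comm _ _ ⟩
    ∏ (λ k → divDiff (A k) (h k)) ∎
    where
    A′ : Vector (List Carrier) n
    A′ = Vector.tail A
    h′ : Fin n → Carrier → Carrier
    h′ = h ∘ Fin.suc

  gridDivDiff≢0⇒∃ : ∀ {n} (A : Vector (List Carrier) n) g → gridDivDiff A g ≢ 0# →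
    ∃ λ v → (∀ i → v i ∈ A i) × g v ≢ 0#
  gridDivDiff≢0⇒∃ {zero} A g g≢0 = Vector.[] , (λ ()) , g≢0
  gridDivDiff≢0⇒∃ {suc n} A g grid≢0 with divDiff≢0⇒∃ (Vector.head A) _ grid≢0
  ... | a , a∈A₀ , inner≢0 with gridDivDiff≢0⇒∃ (Vector.tail A) _ inner≢0
  ... | v , v∈A , g≢0 = a Vector.∷ v , (λ { Fin.zero → a∈A₀ ; (Fin.suc i) → v∈A i }) , g≢0

module Polynomials {t : ℕ} (F : FiniteField t) (n : ℕ) where
  open FieldProperties F
  open Poly F n

  _+ᵐ_ : Monomial → Monomial → Monomial
  (e +ᵐ f) k = e k ℕ.+ f k

  deg : Monomial → ℕ
  deg = ∑

  deg-+ᵐ : ∀ e f → deg (e +ᵐ f) ≡ deg e ℕ.+ deg f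
  deg-+ᵐ = ∑-distrib-+ᴺ

  deg-0 : deg (λ _ → 0) ≡ 0
  deg-0 = ∑-replicate-0 n

  var-self : ∀ i → var i i ≡ 1
  var-self i with i Fin.≟ i
  ... | yes _ = refl
  ... | no i≢i = contradiction refl i≢i

  var-other : ∀ {i j} → j ≢ i → var i j ≡ 0
  var-other {i} {j} j≢i with i Fin.≟ j
  ... | yes i≡j = contradiction (≡.sym i≡j) j≢i
  ... | no _ = refl

  deg-var : ∀ i → deg (var i) ≡ 1
  deg-var i = trans (sum-concentrated ℕ.+-0-commutativeMonoid (var i) i (λ _ → var-other)) (var-self i)

  deg-var+ᵐ : ∀ i e → deg (var i +ᵐ e) ≡ suc (deg e)
  deg-var+ᵐ i e = trans (deg-+ᵐ (var i) e) (cong (ℕ._+ deg e) (deg-var i))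

  evalMonomial : Vector Carrier n → Monomial → Carrier
  evalMonomial v e = ∏ (λ k → v k ^ e k)

  evalMonomial-+ᵐ : ∀ v e f → evalMonomial v (e +ᵐ f) ≡ evalMonomial v e * evalMonomial v f
  evalMonomial-+ᵐ v e f =
    trans (∏-cong-≗ {n} (λ k → ^-homo-* (v k) (e k) (f k))) (∏-distrib-* (λ k → v k ^ e k) (λ k → v k ^ f k))

  evalMonomial-var : ∀ v i → evalMonomial v (var i) ≡ v i
  evalMonomial-var v i = begin
    ∏ (λ k → v k ^ var i k)
      ≡⟨ sum-concentrated *-commutativeMonoid _ i (λ j j≢i → cong (v j ^_) (var-other j≢i)) ⟩
    v i ^ var i i            ≡⟨ cong (v i ^_) (var-self i) ⟩
    v i * 1#                 ≡⟨ *-identityʳ (v i) ⟩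
    v i                      ∎

  -- The linear functional with values w on monomials: evaluation at v and extraction
  -- of a coefficient are both of this form.
  evalWith : (Monomial → Carrier) → Polynomial → Carrier
  evalWith w [] = 0#
  evalWith w ((c , e) ∷ p) = c * w e + evalWith w p

  eval : Vector Carrier n → Polynomial → Carrier
  eval v = evalWith (evalMonomial v)

  shift : Monomial → (Monomial → Carrier) → Monomial → Carrier
  shift e w f = w (e +ᵐ f)

  evalWith-cong : ∀ p {w w′} → All (λ a → w (proj₂ a) ≡ w′ (proj₂ a)) p → evalWith w p ≡ evalWith w′ p
  evalWith-cong [] [] = refl
  evalWith-cong ((c , e) ∷ p) (we≡w′e ∷ w≡w′) = cong₂ _+_ (cong (c *_) we≡w′e) (evalWith-cong p w≡w′)

  evalWith-cong-≗ : ∀ p {w w′} → w ≗ w′ → evalWith w p ≡ evalWith w′ p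
  evalWith-cong-≗ p w≗w′ = evalWith-cong p (All.universal (w≗w′ ∘ proj₂) p)

  evalWith-*ˡ : ∀ k w p → evalWith (λ e → k * w e) p ≡ k * evalWith w p
  evalWith-*ˡ k w [] = ≡.sym (zeroʳ k)
  evalWith-*ˡ k w ((c , e) ∷ p) =
    trans (cong₂ _+_ (*.x∙yz≈y∙xz c k (w e)) (evalWith-*ˡ k w p)) (≡.sym (distribˡ k _ _))

  evalWith-zero : ∀ p → evalWith (λ _ → 0#) p ≡ 0#
  evalWith-zero [] = refl
  evalWith-zero ((c , e) ∷ p) = trans (cong₂ _+_ (zeroʳ c) (evalWith-zero p)) (+-identityˡ 0#)

  evalWith-++ : ∀ w p q → evalWith w (p ++ q) ≡ evalWith w p + evalWith w q
  evalWith-++ w [] q = ≡.sym (+-identityˡ _)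
  evalWith-++ w ((c , e) ∷ p) q = trans (cong (c * w e +_) (evalWith-++ w p q)) (≡.sym (+-assoc _ _ _))

  _*ᵗ_ : Term → Polynomial → Polynomial
  a *ᵗ q = map (λ b → (proj₁ a * proj₁ b , proj₂ a +ᵐ proj₂ b)) q

  evalWith-*ᵗ : ∀ w a q → evalWith w (a *ᵗ q) ≡ proj₁ a * evalWith (shift (proj₂ a) w) q
  evalWith-*ᵗ w a [] = ≡.sym (zeroʳ _)
  evalWith-*ᵗ w a ((c , e) ∷ q) =
    trans (cong₂ _+_ (*-assoc _ _ _) (evalWith-*ᵗ w a q)) (≡.sym (distribˡ _ _ _))

  evalWith-· : ∀ w p q → evalWith w (p · q) ≡ evalWith (λ e → evalWith (shift e w) q) p
  evalWith-· w [] q = refl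
  evalWith-· w (a ∷ p) q =
    trans (evalWith-++ w (a *ᵗ q) (p · q)) (cong₂ _+_ (evalWith-*ᵗ w a q) (evalWith-· w p q))

  All-· : ∀ {P Q R : ℕ → Set} → (∀ {x y} → P x → Q y → R (x ℕ.+ y)) → ∀ {p q} →
    All (P ∘ deg ∘ proj₂) p → All (Q ∘ deg ∘ proj₂) q → All (R ∘ deg ∘ proj₂) (p · q)
  All-· {P} {Q} {R} combine ps qs =
    All.concat⁺ (All.map⁺ (All.map (λ pa → All.map⁺ (All.map (λ qb → combine-+ᵐ pa qb) qs)) ps))
    where
    combine-+ᵐ : ∀ {e f} → P (deg e) → Q (deg f) → R (deg (e +ᵐ f))
    combine-+ᵐ {e} {f} pe qf = ≡.subst R (≡.sym (deg-+ᵐ e f)) (combine pe qf)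

  diffProduct : List (Fin n × Fin n) → Polynomial
  diffProduct = foldr (λ ij acc → diff (proj₁ ij) (proj₂ ij) · acc) one

  shiftedDiff : Fin n → Fin n → Carrier → Polynomial
  shiftedDiff i j b = diff i j ++ (- b , (λ _ → 0)) ∷ []

  shiftedDiffProduct : (Fin n → Fin n → Carrier) → List (Fin n × Fin n) → Polynomial
  shiftedDiffProduct β =
    foldr (λ ij acc → shiftedDiff (proj₁ ij) (proj₂ ij) (β (proj₁ ij) (proj₂ ij)) · acc) one

  diffProduct-homogeneous : ∀ es → All (λ a → deg (proj₂ a) ≡ length es) (diffProduct es)
  diffProduct-homogeneous [] = deg-0 ∷ []
  diffProduct-homogeneous ((i , j) ∷ es) =
    All-· {P = _≡ 1} {Q = _≡ length es} {R = _≡ suc (length es)} (cong₂ ℕ._+_)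
      (deg-var i ∷ deg-var j ∷ []) (diffProduct-homogeneous es)

  shiftedDiffProduct-degree≤ : ∀ β es → All (λ a → deg (proj₂ a) ≤ length es) (shiftedDiffProduct β es)
  shiftedDiffProduct-degree≤ β [] = ℕ.≤-reflexive deg-0 ∷ []
  shiftedDiffProduct-degree≤ β ((i , j) ∷ es) =
    All-· {P = _≤ 1} {Q = _≤ length es} {R = _≤ suc (length es)} ℕ.+-mono-≤
      (ℕ.≤-reflexive (deg-var i) ∷ ℕ.≤-reflexive (deg-var j) ∷ ℕ.m≤n⇒m≤1+n (ℕ.≤-reflexive deg-0) ∷ [])
      (shiftedDiffProduct-degree≤ β es)

  shiftedDiffProduct-leading : ∀ β es w → (∀ e → deg e < length es → w e ≡ 0#) →
    evalWith w (shiftedDiffProduct β es) ≡ evalWith w (diffProduct es)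
  shiftedDiffProduct-leading β [] w _ = refl
  shiftedDiffProduct-leading β ((i , j) ∷ es) w low≡0 = begin
    evalWith w (shiftedDiff i j b · S)
      ≡⟨ evalWith-· w (shiftedDiff i j b) S ⟩
    evalWith W (diff i j ++ (- b , (λ _ → 0)) ∷ [])
      ≡⟨ evalWith-++ W (diff i j) ((- b , (λ _ → 0)) ∷ []) ⟩
    evalWith W (diff i j) + ((- b) * evalWith w S + 0#)
      ≡⟨ cong₂ _+_ (evalWith-cong (diff i j) {W} {W′} (shifted-agree i ∷ shifted-agree j ∷ []))
                   constant-term-vanishes ⟩
    evalWith W′ (diff i j) + 0#
      ≡⟨ +-identityʳ _ ⟩
    evalWith W′ (diff i j)
      ≡⟨ evalWith-· w (diff i j) D ⟨
    evalWith w (diff i j · D) ∎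
    where
    b : Carrier
    b = β i j
    S D : Polynomial
    S = shiftedDiffProduct β es
    D = diffProduct es
    W W′ : Monomial → Carrier
    W e = evalWith (shift e w) S
    W′ e = evalWith (shift e w) D
    shifted-agree : ∀ k → W (var k) ≡ W′ (var k)
    shifted-agree k = shiftedDiffProduct-leading β es (shift (var k) w) λ e deg<∣es∣ →
      low≡0 (var k +ᵐ e) (s≤s (ℕ.≤-trans (ℕ.≤-reflexive (deg-var+ᵐ k e)) deg<∣es∣))
    constant-term-vanishes : (- b) * evalWith w S + 0# ≡ 0#
    constant-term-vanishes = begin
      (- b) * evalWith w S + 0#           ≡⟨ +-identityʳ _ ⟩
      (- b) * evalWith w S
        ≡⟨ cong ((- b) *_) (evalWith-cong S {w} {λ _ → 0#}
                              (All.map (λ deg≤ → low≡0 _ (s≤s deg≤)) (shiftedDiffProduct-degree≤ β es))) ⟩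
      (- b) * evalWith (λ _ → 0#) S       ≡⟨ cong ((- b) *_) (evalWith-zero S) ⟩
      (- b) * 0#                          ≡⟨ zeroʳ _ ⟩
      0#                                  ∎

  evalMonomial-0 : ∀ v → evalMonomial v (λ _ → 0) ≡ 1#
  evalMonomial-0 v = ∏-one {n} (λ k → v k ^ 0) (λ _ → refl)

  eval-· : ∀ v p q → eval v (p · q) ≡ eval v p * eval v q
  eval-· v p q = begin
    eval v (p · q)                                  ≡⟨ evalWith-· (evalMonomial v) p q ⟩
    evalWith (λ e → evalWith (shift e (evalMonomial v)) q) p
      ≡⟨ evalWith-cong-≗ p (λ e → trans (evalWith-cong-≗ q (evalMonomial-+ᵐ v e))
                                        (evalWith-*ˡ _ (evalMonomial v) q)) ⟩
    evalWith (λ e → evalMonomial v e * eval v q) p  ≡⟨ evalWith-cong-≗ p (λ e → *-comm _ (eval v q)) ⟩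
    evalWith (λ e → eval v q * evalMonomial v e) p  ≡⟨ evalWith-*ˡ (eval v q) (evalMonomial v) p ⟩
    eval v q * eval v p                             ≡⟨ *-comm _ _ ⟩
    eval v p * eval v q                             ∎

  eval-shiftedDiff : ∀ v i j b → eval v (shiftedDiff i j b) ≡ (v i - v j) - b
  eval-shiftedDiff v i j b = begin
    1# * evalMonomial v (var i) + ((- 1#) * evalMonomial v (var j) + ((- b) * evalMonomial v (λ _ → 0) + 0#))
      ≡⟨ cong₂ _+_ (trans (*-identityˡ _) (evalMonomial-var v i))
                   (cong₂ _+_ (trans (-1*x≈-x _) (cong -_ (evalMonomial-var v j))) constant-term) ⟩
    v i + (- v j + - b)
      ≡⟨ +-assoc (v i) (- v j) (- b) ⟨
    (v i - v j) - b ∎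
    where
    constant-term : (- b) * evalMonomial v (λ _ → 0) + 0# ≡ - b
    constant-term = trans (+-identityʳ _) (trans (cong ((- b) *_) (evalMonomial-0 v)) (*-identityʳ (- b)))

  eval-shiftedDiffProduct≢0 : ∀ v β es → eval v (shiftedDiffProduct β es) ≢ 0# →
    All (uncurry λ i j → v i - v j ≢ β i j) es
  eval-shiftedDiffProduct≢0 v β [] _ = []
  eval-shiftedDiffProduct≢0 v β ((i , j) ∷ es) eval≢0 =
    (λ vᵢ-vⱼ≡β → eval≢0 (begin
      eval v (shiftedDiff i j (β i j) · S)      ≡⟨ eval-step ⟩
      ((v i - v j) - β i j) * eval v S          ≡⟨ cong (_* eval v S) (x≈y⇒x∙y⁻¹≈ε vᵢ-vⱼ≡β) ⟩
      0# * eval v S                             ≡⟨ zeroˡ _ ⟩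
      0#                                        ∎))
    ∷ eval-shiftedDiffProduct≢0 v β es (x*y≢0⇒y≢0 _ (eval≢0 ∘ trans eval-step))
    where
    S : Polynomial
    S = shiftedDiffProduct β es
    eval-step : eval v (shiftedDiff i j (β i j) · S) ≡ ((v i - v j) - β i j) * eval v S
    eval-step = trans (eval-· v (shiftedDiff i j (β i j)) S)
                      (cong (_* eval v S) (eval-shiftedDiff v i j (β i j)))

module Nullstellensatz {t : ℕ} (F : FiniteField t) (n : ℕ) where
  open FieldProperties F
  open DividedDifference F
  open GridDivDiff F
  open Poly F n
  open Polynomials F n

  indicator : Monomial → Monomial → Carrier
  indicator ts e with monEq? e ts
  ... | yes _ = 1#
  ... | no _ = 0#

  indicator-off : ∀ ts e → ¬ (∀ k → e k ≡ ts k) → indicator ts e ≡ 0#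
  indicator-off ts e e≢ts with monEq? e ts
  ... | yes e≗ts = contradiction e≗ts e≢ts
  ... | no _ = refl

  indicator-off-deg : ∀ ts e → deg e ≢ deg ts → indicator ts e ≡ 0#
  indicator-off-deg ts e deg≢ = indicator-off ts e (deg≢ ∘ ∑-cong-≗)

  sumCoefficients : Polynomial → Carrier
  sumCoefficients = foldr (λ a acc → proj₁ a + acc) 0#

  coeff≡evalWith-indicator : ∀ p ts → coeff p ts ≡ evalWith (indicator ts) p
  coeff≡evalWith-indicator [] ts = refl
  coeff≡evalWith-indicator ((c , e) ∷ p) ts with monEq? e ts
  ... | yes e≗ts = trans (cong sumCoefficients (List.filter-accept (λ a → monEq? (proj₂ a) ts) e≗ts))
                         (cong₂ _+_ (≡.sym (*-identityʳ c)) (coeff≡evalWith-indicator p ts))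
  ... | no e≢ts = trans (cong sumCoefficients (List.filter-reject (λ a → monEq? (proj₂ a) ts) e≢ts))
                        (trans (coeff≡evalWith-indicator p ts) (≡.sym c*0+rest≡rest))
    where
    c*0+rest≡rest : c * 0# + evalWith (indicator ts) p ≡ evalWith (indicator ts) p
    c*0+rest≡rest = trans (cong (_+ evalWith (indicator ts) p) (zeroʳ c)) (+-identityˡ _)

  coeff-diffProduct≢0⇒deg≡ : ∀ es ts → coeff (diffProduct es) ts ≢ 0# → deg ts ≡ length es
  coeff-diffProduct≢0⇒deg≡ es ts coeff≢0 with deg ts ℕ.≟ length es
  ... | yes deg≡ = deg≡
  ... | no deg≢ = contradiction (begin
    coeff (diffProduct es) ts                  ≡⟨ coeff≡evalWith-indicator (diffProduct es) ts ⟩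
    evalWith (indicator ts) (diffProduct es)   ≡⟨ evalWith-cong (diffProduct es) {indicator ts} {λ _ → 0#}
                                                    (All.map off-degree (diffProduct-homogeneous es)) ⟩
    evalWith (λ _ → 0#) (diffProduct es)       ≡⟨ evalWith-zero (diffProduct es) ⟩
    0#                                         ∎) coeff≢0
    where
    off-degree : ∀ {e} → deg e ≡ length es → indicator ts e ≡ 0#
    off-degree deg≡∣es∣ = indicator-off-deg ts _ (λ deg≡ → deg≢ (trans (≡.sym deg≡) deg≡∣es∣))

  gridDivDiff-eval : ∀ A p →
    gridDivDiff A (λ v → eval v p) ≡ evalWith (λ e → gridDivDiff A (λ v → evalMonomial v e)) p
  gridDivDiff-eval A [] = gridDivDiff-zero A
  gridDivDiff-eval A ((c , e) ∷ p) =
    trans (gridDivDiff-+ A _ _) (cong₂ _+_ (gridDivDiff-*ˡ A c _) (gridDivDiff-eval A p))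

  gridDivDiff-monomial : ∀ (A : Vector (List Carrier) n) ts →
    (∀ i → Unique (A i)) → (∀ i → length (A i) ≡ suc (ts i)) →
    ∀ e → deg e ≤ deg ts → gridDivDiff A (λ v → evalMonomial v e) ≡ indicator ts e
  gridDivDiff-monomial A ts A-unique A-length e deg≤ with monEq? e ts
  ... | yes e≗ts = trans (gridDivDiff-∏ A (λ k a → a ^ e k))
    (∏-one _ (λ k → trans (cong (λ x → divDiff (A k) (_^ x)) (e≗ts k))
                          (divDiff-^-top (A k) (A-unique k) (A-length k))))
  ... | no e≢ts with ∑≤∑∧≢⇒∃< e ts deg≤ e≢ts
  ... | k , eₖ<tsₖ = trans (gridDivDiff-∏ A (λ k a → a ^ e k))
    (∏-zero _ k (divDiff-^-< (e k) (A k) (A-unique k) (A-length k) eₖ<tsₖ))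

  gridDivDiff-shiftedDiffProduct : ∀ (A : Vector (List Carrier) n) ts β es →
    (∀ i → Unique (A i)) → (∀ i → length (A i) ≡ suc (ts i)) → deg ts ≡ length es →
    gridDivDiff A (λ v → eval v (shiftedDiffProduct β es)) ≡ coeff (diffProduct es) ts
  gridDivDiff-shiftedDiffProduct A ts β es A-unique A-length deg-ts = begin
    gridDivDiff A (λ v → eval v S)
      ≡⟨ gridDivDiff-eval A S ⟩
    evalWith (λ e → gridDivDiff A (λ v → evalMonomial v e)) S
      ≡⟨ evalWith-cong S (All.map (λ deg≤ → gridDivDiff-monomial A ts A-unique A-length _
                                              (ℕ.≤-trans deg≤ ∣es∣≤deg-ts))
                                  (shiftedDiffProduct-degree≤ β es)) ⟩
    evalWith (indicator ts) S
      ≡⟨ shiftedDiffProduct-leading β es (indicator ts)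
           (λ e deg< → indicator-off-deg ts e (λ deg≡ → ℕ.<-irrefl (trans deg≡ deg-ts) deg<)) ⟩
    evalWith (indicator ts) (diffProduct es)
      ≡⟨ coeff≡evalWith-indicator (diffProduct es) ts ⟨
    coeff (diffProduct es) ts ∎
    where
    S : Polynomial
    S = shiftedDiffProduct β es
    ∣es∣≤deg-ts : length es ≤ deg ts
    ∣es∣≤deg-ts = ℕ.≤-reflexive (≡.sym deg-ts)

  gridPoint-avoiding-shifts : ∀ (A : Vector (List Carrier) n) ts β es →
    (∀ i → Unique (A i)) → (∀ i → length (A i) ≡ suc (ts i)) → coeff (diffProduct es) ts ≢ 0# →
    Σ (Vector Carrier n) λ v → (∀ i → v i ∈ A i) × All (uncurry λ i j → v i - v j ≢ β i j) es
  gridPoint-avoiding-shifts A ts β es A-unique A-length coeff≢0 =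
    let (v , v∈A , eval≢0) = gridDivDiff≢0⇒∃ A _ (coeff≢0 ∘ trans (≡.sym grid≡coeff))
    in v , v∈A , eval-shiftedDiffProduct≢0 v β es eval≢0
    where
    grid≡coeff : gridDivDiff A (λ v → eval v (shiftedDiffProduct β es)) ≡ coeff (diffProduct es) ts
    grid≡coeff = gridDivDiff-shiftedDiffProduct A ts β es A-unique A-length
                   (coeff-diffProduct≢0⇒deg≡ es ts coeff≢0)

choose-where-decidable : ∀ {a b p q} {I : Set a} {B : Set b} {Q : I → Set q} {P : I → B → Set p} →
  B → (∀ i → Dec (Q i)) → (∀ i → Q i → Σ B (P i)) → Σ (I → B) λ f → ∀ i → Q i → P i (f i)
choose-where-decidable {I = I} {B} {Q} {P} default Q? choice = f , f-spec
  where
  f : I → B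
  f i with Q? i
  ... | yes qᵢ = proj₁ (choice i qᵢ)
  ... | no _ = default
  f-spec : ∀ i → Q i → P i (f i)
  f-spec i qᵢ with Q? i
  ... | yes qᵢ = proj₂ (choice i qᵢ)
  ... | no ¬qᵢ = contradiction qᵢ ¬qᵢ

module GoodCover {n : ℕ} {G : Graph n} {t : ℕ} (F : FiniteField t) (C : Cover G) where
  open FieldProperties F
  open Poly F n using (pairs)

  edges : List (Fin n × Fin n)
  edges = filter (λ ij → Bool._≟_ (Adj G (proj₁ ij) (proj₂ ij)) true) pairs

  ∈-edges : ∀ {i j} → i Fin.< j → Adj G i j ≡ true → (i , j) ∈ edges
  ∈-edges {i} {j} i<j ij∈E =
    Membership.∈-filter⁺ (λ ij → Bool._≟_ (Adj G (proj₁ ij) (proj₂ ij)) true) ij∈pairs ij∈E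
    where
    ij∈pairs : (i , j) ∈ pairs
    ij∈pairs = Membership.∈-concatMap⁺ _ (Any.map (λ { refl → Membership.∈-map⁺ (i ,_)
                 (Membership.∈-filter⁺ (i Fin.<?_) (Membership.∈-allFin j) i<j) }) (Membership.∈-allFin i))

  module Naming (ν : Fin (m C) → Carrier)
                (ν-injective : ∀ x y → part C x ≡ part C y → ν x ≡ ν y → x ≡ y) where

    GoodShifts : (Fin n → Fin n → Carrier) → Set
    GoodShifts β = ∀ i j → i Fin.< j → Adj G i j ≡ true →
      ∀ x y → part C x ≡ i → part C y ≡ j → AdjH C x y ≡ true → ν x - ν y ≡ β i j

    goodShifts : (∀ i j → i Fin.< j → Adj G i j ≡ true → Σ Carrier λ β →
                   ∀ x y → part C x ≡ i → part C y ≡ j → AdjH C x y ≡ true → ν x - ν y ≡ β) →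
                 Σ (Fin n → Fin n → Carrier) GoodShifts
    goodShifts good with choose-where-decidable
        {P = λ ij β → ∀ x y → part C x ≡ proj₁ ij → part C y ≡ proj₂ ij → AdjH C x y ≡ true → ν x - ν y ≡ β}
        0# (λ ij → (proj₁ ij Fin.<? proj₂ ij) ×-dec (Adj G (proj₁ ij) (proj₂ ij) Bool.≟ true))
        (λ ij q → good (proj₁ ij) (proj₂ ij) (proj₁ q) (proj₂ q))
    ... | β , β-spec = (λ i j → β (i , j)) , (λ i j i<j ij∈E → β-spec (i , j) (i<j , ij∈E))

    firstVertices : ℕ → Fin n → List (Fin (m C))
    firstVertices k i = take k (L C i)

    firstNames : ℕ → Fin n → List Carrier
    firstNames k i = map ν (firstVertices k i)

    firstVertices-part : ∀ k i → All (λ x → part C x ≡ i) (firstVertices k i)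
    firstVertices-part k i = All.take⁺ k (All.all-filter (λ x → part C x Fin.≟ i) (allFin (m C)))

    firstNames-unique : ∀ k i → Unique (firstNames k i)
    firstNames-unique k i =
      AllPairs.map⁺ (names-distinct (Unique.take⁺ k (Unique.filter⁺ _ (Unique.allFin⁺ (m C))))
                                    (firstVertices-part k i))
      where
      names-distinct : ∀ {xs} → Unique xs → All (λ x → part C x ≡ i) xs → AllPairs (λ x y → ν x ≢ ν y) xs
      names-distinct [] [] = []
      names-distinct (x∉xs ∷ xs-unique) (px ∷ pxs) =
        All.zipWith (λ (x≢y , py) → x≢y ∘ ν-injective _ _ (trans px (≡.sym py))) (x∉xs , pxs)
        ∷ names-distinct xs-unique pxs

    firstNames-length : ∀ k i → k ≤ ∣L∣ C i → length (firstNames k i) ≡ k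
    firstNames-length k i k≤∣L∣ =
      trans (List.length-map ν (firstVertices k i)) (trans (List.length-take k (L C i)) (ℕ.m≤n⇒m⊓n≡m k≤∣L∣))

    ∈-firstNames⁻ : ∀ {k i a} → a ∈ firstNames k i → ∃ λ x → part C x ≡ i × ν x ≡ a
    ∈-firstNames⁻ {k} {i} a∈names with Membership.∈-map⁻ ν a∈names
    ... | x , x∈vertices , a≡νx = x , All.lookup (firstVertices-part k i) x∈vertices , ≡.sym a≡νx

    coloring : ∀ β → GoodShifts β → (c : Fin n → Fin (m C)) → (∀ i → part C (c i) ≡ i) →
      All (uncurry λ i j → ν (c i) - ν (c j) ≢ β i j) edges → Coloring C
    coloring β β-good c c-part avoids = c , c-part , λ u w → Bool.¬-not (no-edge u w)
      where
      no-forward-edge : ∀ {i j} → i Fin.< j → AdjH C (c i) (c j) ≢ true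
      no-forward-edge {i} {j} i<j adj =
        All.lookup avoids (∈-edges i<j ij∈E) (β-good i j i<j ij∈E (c i) (c j) (c-part i) (c-part j) adj)
        where
        ij∈E : Adj G i j ≡ true
        ij∈E = subst₂ (λ a b → Adj G a b ≡ true) (c-part i) (c-part j)
          (respects C (c i) (c j) adj
            (λ same-list → Fin.<-irrefl (trans (≡.sym (c-part i)) (trans same-list (c-part j))) i<j))
      no-edge : ∀ u w → AdjH C (c u) (c w) ≢ true
      no-edge u w with Fin.<-cmp u w
      ... | tri< u<w _ _ = no-forward-edge u<w
      ... | tri> _ _ w<u = no-forward-edge w<u ∘ trans (symH C (c w) (c u))
      ... | tri≈ _ refl _ = λ adj → contradiction (trans (≡.sym adj) (irreflH C (c u))) λ ()

    coloring-from-gridPoint : ∀ β → GoodShifts β → (sizes : Fin n → ℕ) →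
      (Σ (Vector Carrier n) λ v → (∀ i → v i ∈ firstNames (sizes i) i) ×
                                  All (uncurry λ i j → v i - v j ≢ β i j) edges) →
      Coloring C
    coloring-from-gridPoint β β-good sizes (v , v∈names , avoids) =
      coloring β β-good c c-part (All.map (λ avoid → avoid ∘ trans (≡.sym (cong₂ _-_ (ν-c _) (ν-c _)))) avoids)
      where
      c : Fin n → Fin (m C)
      c i = proj₁ (∈-firstNames⁻ (v∈names i))
      c-part : ∀ i → part C (c i) ≡ i
      c-part i = proj₁ (proj₂ (∈-firstNames⁻ (v∈names i)))
      ν-c : ∀ i → ν (c i) ≡ v i
      ν-c i = proj₂ (proj₂ (∈-firstNames⁻ (v∈names i)))

theorem1p3 : (n : ℕ) (G : Graph n) (t : ℕ) (F : FiniteField t) (C : Cover G) →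
    IsGoodPrimeCover t F C →
    (ts : Fin n → ℕ) →
    ¬ (Poly.coeff F n (Poly.graphPoly F n G) ts ≡ FiniteField.0# F) →
    (∀ i → ts i < ∣L∣ C i) →
    Coloring C
theorem1p3 n G t F C (_ , _ , ν , ν-injective , good) ts coeff≢0 ts<∣L∣ =
  coloring-from-gridPoint β β-good (suc ∘ ts)
    (gridPoint-avoiding-shifts (λ i → firstNames (suc (ts i)) i) ts β edges
       (λ i → firstNames-unique _ i) (λ i → firstNames-length _ i (ts<∣L∣ i)) coeff≢0)
  where
  open Nullstellensatz F n using (gridPoint-avoiding-shifts)
  open GoodCover F C using (edges; module Naming)
  open Naming ν ν-injective
  shifts : Σ (Fin n → Fin n → FiniteField.Carrier F) GoodShifts
  shifts = goodShifts good
  β : Fin n → Fin n → FiniteField.Carrier F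
  β = proj₁ shifts
  β-good : GoodShifts β
  β-good = proj₂ shifts
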